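{- Let $p,q,r$ be nonnegative integers and let $G=B'(p,q,r)$, a graph of order $n=p+q+r+2$. Then the characteristic polynomial $\mu(G,x)=\det(xI-L(G))$ of the Laplacian matrix of $G$ satisfies $$\mu(G,x)=x(x-1)^{p+r-2}(x-2)^{q-1}(x^4-a'_1x^3+a'_2x^2-a'_3x+a'_4)$$ (as an identity of rational functions in $x$), where $a'_1=2q+p+r+6$, $a'_2=q^2+(p+r)q+pr+4(2q+p+r)+13$, $a'_3=2(q^2+pq+rq+pr)+5(2q+p+r)+12$, and $a'_4=q^2+(p+r)q+2(2q+p+r)+4$.
   Context: The Laplacian matrix of a simple graph $G$ is $L(G)=D(G)-A(G)$, with $D(G)$ the diagonal degree matrix and $A(G)$ the adjacency matrix. The graph $B(p,q,r)$ has vertex set $\{u,v,w_1,\dots,w_q,u_1,\dots,u_p,v_1,\dots,v_r\}$ and edges $uw_i$, $vw_i$ ($1\le i\le q$), $uu_j$ ($1\le j\le p$), $vv_k$ ($1\le k\le r$). The binary star graph $B'(p,q,r)$ is obtained from $B(p,q,r)$ by adding the edge $uv$. -}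

module Defs where

open import Data.Nat using (ℕ; zero; suc; _<ᵇ_) renaming (_+_ to _+ℕ_)
open import Data.Fin using (Fin; zero; suc; toℕ; punchIn)
open import Data.Fin.Properties using (_≟_)
open import Data.Bool using (Bool; true; false; if_then_else_)
open import Data.Integer using (ℤ; +_; _+_; _-_; _*_; -_; _^_)
open import Relation.Nullary using (does)

sumFin : (n : ℕ) → (Fin n → ℤ) → ℤ
sumFin zero    f = + 0
sumFin (suc n) f = f zero + sumFin n (λ i → f (suc i))

det : (n : ℕ) → (Fin n → Fin n → ℤ) → ℤ
det zero    M = + 1
det (suc n) M =
  sumFin (suc n) (λ j →
    ((- + 1) ^ toℕ j) * M zero j * det n (λ i k → M (suc i) (punchIn j k)))

-- Graphs on vertex set Fin n, given by a (symmetric, irreflexive) Boolean adjacency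
AdjMatrix : (n : ℕ) → (Fin n → Fin n → Bool) → Fin n → Fin n → ℤ
AdjMatrix n adj i j = if adj i j then + 1 else + 0

degree : (n : ℕ) → (Fin n → Fin n → Bool) → Fin n → ℤ
degree n adj i = sumFin n (λ j → AdjMatrix n adj i j)

δ : {n : ℕ} → Fin n → Fin n → ℤ
δ i j = if does (i ≟ j) then + 1 else + 0

Laplacian : (n : ℕ) → (Fin n → Fin n → Bool) → Fin n → Fin n → ℤ
Laplacian n adj i j = δ i j * degree n adj i - AdjMatrix n adj i j

laplacianCharPoly : (n : ℕ) → (Fin n → Fin n → Bool) → ℤ → ℤ
laplacianCharPoly n adj x = det n (λ i j → δ i j * x - Laplacian n adj i j)

-- Vertex roles in B'(p,q,r).  Vertex numbering (n = p+q+r+2):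
--   0 = u, 1 = v, 2 .. q+1 = w_1..w_q,
--   q+2 .. q+p+1 = u_1..u_p, q+p+2 .. q+p+r+1 = v_1..v_r
data Role : Set where
  U V W LU LV : Role

role : ℕ → ℕ → ℕ → Role
role p q 0 = U
role p q 1 = V
role p q (suc (suc m)) =
  if m <ᵇ q then W else (if m <ᵇ (q +ℕ p) then LU else LV)

roleAdj : Role → Role → Bool
roleAdj U V  = true
roleAdj V U  = true
roleAdj U W  = true
roleAdj W U  = true
roleAdj V W  = true
roleAdj W V  = true
roleAdj U LU = true
roleAdj LU U = true
roleAdj V LV = true
roleAdj LV V = true
roleAdj _ _  = false

B'adj : (p q r : ℕ) → Fin (p +ℕ q +ℕ r +ℕ 2) → Fin (p +ℕ q +ℕ r +ℕ 2) → Bool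
B'adj p q r i j = roleAdj (role p q (toℕ i)) (role p q (toℕ j))

module Submission where

-- In the vertex order u, v, w_i, u_j, v_k the peripheral vertices w_i, u_j, v_k are pairwise
-- nonadjacent, so the lower right block of xI - L is diagonal, with entries x - 2 at the w_i
-- and x - 1 at the u_j, v_k. Scaling the rows of u and v by (x - 1)(x - 2) and
-- subtracting multiples of the peripheral rows clears the upper right block; hence
-- (x - 1)²(x - 2)² μ(G, x) is a 2×2 determinant times (x - 2)^q (x - 1)^(p+r), and that 2×2
-- determinant is x (x - 2) times the quartic. Cancelling x - 2 proves the identity for x ≠ 2;
-- at x = 2 both sides vanish (for q = 0 because 2 is a root of the quartic).

open import Defs
open import Data.Nat using (ℕ) renaming (_+_ to _+ℕ_; _*_ to _*ℕ_)
open import Data.Integer using (ℤ; +_; _+_; _-_; _*_; _^_)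
open import Relation.Binary.PropositionalEquality using (_≡_)

open import Algebra.Bundles using (Monoid)
import Algebra.Properties.Monoid.Mult
open import Data.Bool using (Bool; true; false; if_then_else_)
open import Data.Bool.Properties using (T-≡)
open import Function.Bundles using (Equivalence)
open import Data.Fin using (Fin; zero; suc; toℕ; punchIn; _<_)
open import Data.Fin.Properties using (_≟_; punchInᵢ≢i)
open import Data.Integer using (-_; 0ℤ; 1ℤ; -1ℤ; +[1+_]; -[1+_]; ≢-nonZero) renaming (_≟_ to _≟ℤ_)
open import Data.Integer.Properties
  using (pos-+; pos-*; +-*-semiring; +-0-monoid; *-1-monoid; -1*i≡-i; neg-involutive; *-assoc; *-distribʳ-+; *-zeroˡ; *-zeroʳ; *-cancelˡ-≡; ^-distribˡ-+-*; *-identityˡ; +-identityˡ; +-identityʳ)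
open import Data.Integer.Tactic.RingSolver using (solve-∀)
open import Data.Nat using (zero; suc; s≤s; z≤n; _<ᵇ_)
import Data.Nat as ℕ
import Data.Nat.Properties as ℕ
open import Data.Vec.Functional using (_∷_)
open import Function using (_∘_)
open import Relation.Binary.PropositionalEquality
  using (_≢_; refl; sym; trans; cong; cong₂; module ≡-Reasoning)
open import Relation.Nullary.Decidable using (Dec; yes; no; dec-true; dec-false)
open import Relation.Nullary.Negation using (contradiction)

open import Algebra.Properties.Semiring.Sum +-*-semiring
  using (sum; sum-cong-≗; sum-replicate-zero; sum-remove; ∑-distrib-+; ∑-comm; *-distribˡ-sum; *-distribʳ-sum)
open import Algebra.Properties.Monoid.Sum *-1-monoid using () renaming (sum to prod)

-- Counting over the vertex roles of B′(p,q,r)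

<⇒<ᵇ≡true : ∀ {m n} → m ℕ.< n → (m <ᵇ n) ≡ true
<⇒<ᵇ≡true m<n = Equivalence.to T-≡ (ℕ.<⇒<ᵇ m<n)

m+n<ᵇm≡false : ∀ m n → (m +ℕ n <ᵇ m) ≡ false
m+n<ᵇm≡false zero    n = refl
m+n<ᵇm≡false (suc m) n = m+n<ᵇm≡false m n

+-cancelˡ-<ᵇ : ∀ m n o → (m +ℕ n <ᵇ m +ℕ o) ≡ (n <ᵇ o)
+-cancelˡ-<ᵇ zero    n o = refl
+-cancelˡ-<ᵇ (suc m) n o = +-cancelˡ-<ᵇ m n o

module RoleFold {c ℓ} (𝕄 : Monoid c ℓ) where
  open Monoid 𝕄 using (Carrier; _≈_; _∙_; ε; setoid; reflexive; assoc; identityˡ; ∙-cong; ∙-congˡ)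
    renaming (refl to ≈-refl; sym to ≈-sym)
  open import Algebra.Properties.Monoid.Sum 𝕄 using () renaming (sum to fold)
  open import Algebra.Properties.Monoid.Mult 𝕄 using (_×_)
  open import Relation.Binary.Reasoning.Setoid setoid

  foldRange : ℕ → (ℕ → Carrier) → Carrier
  foldRange zero    h = ε
  foldRange (suc n) h = h 0 ∙ foldRange n (h ∘ suc)

  fold≈foldRange : ∀ n (h : ℕ → Carrier) → fold {n} (h ∘ toℕ) ≈ foldRange n h
  fold≈foldRange zero    h = ≈-refl
  fold≈foldRange (suc n) h = ∙-congˡ (fold≈foldRange n (h ∘ suc))

  foldRange-+ : ∀ a b (h : ℕ → Carrier) → foldRange (a +ℕ b) h ≈ foldRange a h ∙ foldRange b (λ i → h (a +ℕ i))
  foldRange-+ zero    b h = ≈-sym (identityˡ _)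
  foldRange-+ (suc a) b h = begin
    h 0 ∙ foldRange (a +ℕ b) (h ∘ suc)                                  ≈⟨ ∙-congˡ (foldRange-+ a b (h ∘ suc)) ⟩
    h 0 ∙ (foldRange a (h ∘ suc) ∙ foldRange b (λ i → h (suc a +ℕ i)))  ≈⟨ assoc _ _ _ ⟨
    h 0 ∙ foldRange a (h ∘ suc) ∙ foldRange b (λ i → h (suc a +ℕ i))    ∎

  foldRange-cong : ∀ n {h h′ : ℕ → Carrier} → (∀ i → i ℕ.< n → h i ≈ h′ i) → foldRange n h ≈ foldRange n h′
  foldRange-cong zero    h≈h′ = ≈-refl
  foldRange-cong (suc n) h≈h′ = ∙-cong (h≈h′ 0 (s≤s z≤n)) (foldRange-cong n (λ i i<n → h≈h′ (suc i) (s≤s i<n)))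

  foldRange-const : ∀ n v → foldRange n (λ _ → v) ≈ n × v
  foldRange-const zero    v = ≈-refl
  foldRange-const (suc n) v = ∙-congˡ (foldRange-const n v)

  fold-role : ∀ p q r (g : Role → Carrier) →
    fold {p +ℕ q +ℕ r} (λ c → g (role p q (suc (suc (toℕ c))))) ≈ q × g W ∙ (p × g LU ∙ r × g LV)
  fold-role p q r g = begin
    fold {p +ℕ q +ℕ r} (h ∘ toℕ)                                                ≈⟨ fold≈foldRange (p +ℕ q +ℕ r) h ⟩
    foldRange (p +ℕ q +ℕ r) h                                             ≡⟨ cong (λ n → foldRange n h) (trans (cong (ℕ._+ r) (ℕ.+-comm p q)) (ℕ.+-assoc q p r)) ⟩
    foldRange (q +ℕ (p +ℕ r)) h                                           ≈⟨ foldRange-+ q (p +ℕ r) h ⟩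
    foldRange q h ∙ foldRange (p +ℕ r) (λ i → h (q +ℕ i))                 ≈⟨ ∙-congˡ (foldRange-+ p r (λ i → h (q +ℕ i))) ⟩
    foldRange q h ∙ (foldRange p (λ i → h (q +ℕ i)) ∙ foldRange r (λ i → h (q +ℕ (p +ℕ i))))
      ≈⟨ ∙-cong (foldRange-cong q on-W) (∙-cong (foldRange-cong p on-LU) (foldRange-cong r (λ i _ → on-LV i))) ⟩
    foldRange q (λ _ → g W) ∙ (foldRange p (λ _ → g LU) ∙ foldRange r (λ _ → g LV))
      ≈⟨ ∙-cong (foldRange-const q (g W)) (∙-cong (foldRange-const p (g LU)) (foldRange-const r (g LV))) ⟩
    q × g W ∙ (p × g LU ∙ r × g LV)                                       ∎
    where
    h : ℕ → Carrier
    h i = g (role p q (suc (suc i)))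
    on-W : ∀ i → i ℕ.< q → h i ≈ g W
    on-W i i<q = reflexive (cong (λ b → g (if b then W else (if i <ᵇ q +ℕ p then LU else LV))) (<⇒<ᵇ≡true i<q))
    on-LU : ∀ i → i ℕ.< p → h (q +ℕ i) ≈ g LU
    on-LU i i<p = reflexive (cong₂ (λ b b′ → g (if b then W else (if b′ then LU else LV)))
                                  (m+n<ᵇm≡false q i) (trans (+-cancelˡ-<ᵇ q i p) (<⇒<ᵇ≡true i<p)))
    on-LV : ∀ i → h (q +ℕ (p +ℕ i)) ≈ g LV
    on-LV i = reflexive (cong₂ (λ b b′ → g (if b then W else (if b′ then LU else LV)))
                               (m+n<ᵇm≡false q (p +ℕ i)) (trans (+-cancelˡ-<ᵇ q (p +ℕ i) p) (m+n<ᵇm≡false p i)))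

open ≡-Reasoning

-- Finite sums and the Kronecker delta

sumFin≡sum : ∀ n (f : Fin n → ℤ) → sumFin n f ≡ sum f
sumFin≡sum zero    f = refl
sumFin≡sum (suc n) f = cong (_+_ (f zero)) (sumFin≡sum n (f ∘ suc))

sum-zero : ∀ {n} {f : Fin n → ℤ} → (∀ i → f i ≡ 0ℤ) → sum f ≡ 0ℤ
sum-zero {n} f≗0 = trans (sum-cong-≗ f≗0) (sum-replicate-zero n)

neg-distrib-sum : ∀ {n} (f : Fin n → ℤ) → - sum f ≡ sum (λ i → - f i)
neg-distrib-sum f = begin
  - sum f                ≡⟨ -1*i≡-i (sum f) ⟨
  -1ℤ * sum f            ≡⟨ *-distribˡ-sum -1ℤ f ⟩
  sum (λ i → -1ℤ * f i)  ≡⟨ sum-cong-≗ (λ i → -1*i≡-i (f i)) ⟩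
  sum (λ i → - f i)      ∎

sum-punchIn : ∀ {n} (j : Fin (suc n)) (f : Fin (suc n) → ℤ) → f j ≡ 0ℤ →
              sum f ≡ sum (λ k → f (punchIn j k))
sum-punchIn j f fj≡0 = begin
  sum f                                ≡⟨ sum-remove {i = j} f ⟩
  f j + sum (λ k → f (punchIn j k))    ≡⟨ cong (λ t → t + sum (λ k → f (punchIn j k))) fj≡0 ⟩
  0ℤ + sum (λ k → f (punchIn j k))     ≡⟨ +-identityˡ _ ⟩
  sum (λ k → f (punchIn j k))          ∎

sum-head : ∀ {n} (f : Fin (suc n) → ℤ) → (∀ c → f (suc c) ≡ 0ℤ) → sum f ≡ f zero
sum-head f tail≡0 = trans (cong (_+_ (f zero)) (sum-zero tail≡0)) (+-identityʳ (f zero))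

sum-head₂ : ∀ {n} (f : Fin (suc (suc n)) → ℤ) → (∀ c → f (suc (suc c)) ≡ 0ℤ) → sum f ≡ f zero + f (suc zero)
sum-head₂ f tail≡0 = cong (_+_ (f zero)) (sum-head (f ∘ suc) tail≡0)

δ-refl : ∀ {n} (i : Fin n) → δ i i ≡ 1ℤ
δ-refl i = cong (if_then + 1 else + 0) (dec-true (i ≟ i) refl)

δ-≢ : ∀ {n} {i j : Fin n} → i ≢ j → δ i j ≡ 0ℤ
δ-≢ {i = i} {j} i≢j = cong (if_then + 1 else + 0) (dec-false (i ≟ j) i≢j)

sum-δ : ∀ {n} (c : Fin n) (f : Fin n → ℤ) → sum (λ k → δ k c * f k) ≡ f c
sum-δ {suc n} c f = begin
  sum (λ k → δ k c * f k)                                ≡⟨ sum-remove {i = c} (λ k → δ k c * f k) ⟩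
  δ c c * f c + sum (λ k → δ (punchIn c k) c * f (punchIn c k))
    ≡⟨ cong₂ _+_ (cong (_* f c) (δ-refl c))
                 (sum-zero (λ k → trans (cong (_* f (punchIn c k)) (δ-≢ (punchInᵢ≢i c k))) (*-zeroˡ (f (punchIn c k))))) ⟩
  1ℤ * f c + 0ℤ                                          ≡⟨ +-identityʳ (1ℤ * f c) ⟩
  1ℤ * f c                                               ≡⟨ *-identityˡ (f c) ⟩
  f c                                                    ∎

-- Determinants

Matrix : ℕ → Set
Matrix n = Fin n → Fin n → ℤ

sign : ∀ {n} → Fin n → ℤ
sign j = -1ℤ ^ toℕ j

minor : ∀ {n} → Matrix (suc n) → Fin (suc n) → Matrix n
minor M j i k = M (suc i) (punchIn j k)

cofactor : ∀ {n} → Matrix (suc n) → Fin (suc n) → ℤ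
cofactor {n} M j = sign j * det n (minor M j)

det-expand : ∀ {n} (M : Matrix (suc n)) → det (suc n) M ≡ sum (λ j → M zero j * cofactor M j)
det-expand {n} M = trans (sumFin≡sum (suc n) (λ j → sign j * M zero j * det n (minor M j)))
                         (sum-cong-≗ λ j → reassoc (sign j) (M zero j) (det n (minor M j)))
  where
  reassoc : ∀ s a d → s * a * d ≡ a * (s * d)
  reassoc = solve-∀

det-cong : ∀ n {M N : Matrix n} → (∀ i j → M i j ≡ N i j) → det n M ≡ det n N
det-cong zero    M≗N = refl
det-cong (suc n) M≗N = sumFin-cong λ j →
  cong₂ _*_ (cong (sign j *_) (M≗N zero j)) (det-cong n (λ i k → M≗N (suc i) (punchIn j k)))
  where
  sumFin-cong : ∀ {f g : Fin (suc n) → ℤ} → (∀ j → f j ≡ g j) → sumFin (suc n) f ≡ sumFin (suc n) g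
  sumFin-cong {f} {g} f≗g = trans (sumFin≡sum (suc n) f) (trans (sum-cong-≗ f≗g) (sym (sumFin≡sum (suc n) g)))

withTopRows : ∀ {n} → (R₀ R₁ : Fin (suc (suc n)) → ℤ) → Matrix (suc (suc n)) → Matrix (suc (suc n))
withTopRows R₀ R₁ M zero          = R₀
withTopRows R₀ R₁ M (suc zero)    = R₁
withTopRows R₀ R₁ M (suc (suc i)) = M (suc (suc i))

withTopRows-id : ∀ {n} (M : Matrix (suc (suc n))) i j → withTopRows (M zero) (M (suc zero)) M i j ≡ M i j
withTopRows-id M zero          j = refl
withTopRows-id M (suc zero)    j = refl
withTopRows-id M (suc (suc i)) j = refl

swap₀₁ : ∀ {n} → Matrix (suc (suc n)) → Matrix (suc (suc n))
swap₀₁ M = withTopRows (M (suc zero)) (M zero) M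

-- A total version of punchOut: the position of b among the indices other than j
-- (junk when b ≡ j).
punchOut′ : ∀ {n} → Fin (suc (suc n)) → Fin (suc (suc n)) → Fin (suc n)
punchOut′ zero          zero    = zero
punchOut′ zero          (suc b) = b
punchOut′ (suc j)       zero    = zero
punchOut′ {zero} (suc j) (suc b) = zero
punchOut′ {suc n} (suc j) (suc b) = suc (punchOut′ j b)

punchOut′-punchIn : ∀ {n} (j : Fin (suc (suc n))) (k : Fin (suc n)) → punchOut′ j (punchIn j k) ≡ k
punchOut′-punchIn zero    k       = refl
punchOut′-punchIn (suc j) zero    = refl
punchOut′-punchIn {suc n} (suc j) (suc k) = cong suc (punchOut′-punchIn j k)

punchIn-punchOut′-comm : ∀ {n} (j b : Fin (suc (suc n))) → j ≢ b → (l : Fin n) →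
  punchIn j (punchIn (punchOut′ j b) l) ≡ punchIn b (punchIn (punchOut′ b j) l)
punchIn-punchOut′-comm zero    zero    j≢b l = contradiction refl j≢b
punchIn-punchOut′-comm zero    (suc b) j≢b l = refl
punchIn-punchOut′-comm (suc j) zero    j≢b l = refl
punchIn-punchOut′-comm {suc n} (suc j) (suc b) j≢b zero    = refl
punchIn-punchOut′-comm {suc n} (suc j) (suc b) j≢b (suc l) =
  cong suc (punchIn-punchOut′-comm j b (j≢b ∘ cong suc) l)

sign-punchOut′ : ∀ {n} (j b : Fin (suc (suc n))) → j ≢ b →
  sign j * sign (punchOut′ j b) ≡ - (sign b * sign (punchOut′ b j))
sign-punchOut′ zero    zero    j≢b = contradiction refl j≢b
sign-punchOut′ zero    (suc b) j≢b = flip-left (sign b)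
  where
  flip-left : ∀ s → 1ℤ * s ≡ - ((-1ℤ * s) * 1ℤ)
  flip-left = solve-∀
sign-punchOut′ (suc j) zero    j≢b = flip-right (sign j)
  where
  flip-right : ∀ s → (-1ℤ * s) * 1ℤ ≡ - (1ℤ * s)
  flip-right = solve-∀
sign-punchOut′ {zero}  (suc zero) (suc zero) j≢b = contradiction refl j≢b
sign-punchOut′ {suc n} (suc j) (suc b) j≢b = begin
  (-1ℤ * sign j) * (-1ℤ * sign (punchOut′ j b)) ≡⟨ square-sign (sign j) (sign (punchOut′ j b)) ⟩
  sign j * sign (punchOut′ j b)                 ≡⟨ sign-punchOut′ j b (j≢b ∘ cong suc) ⟩
  - (sign b * sign (punchOut′ b j))             ≡⟨ cong -_ (square-sign (sign b) (sign (punchOut′ b j))) ⟨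
  - ((-1ℤ * sign b) * (-1ℤ * sign (punchOut′ b j))) ∎
  where
  square-sign : ∀ s t → (-1ℤ * s) * (-1ℤ * t) ≡ s * t
  square-sign = solve-∀

-- Expanding along rows 0 and 1 makes det a bilinear form in these rows. The factor 1 - δ j b
-- extends the inner expansion, over the columns b ≢ j, to all b, so that the double sum can be
-- reindexed with ∑-comm when the two rows are swapped.
module TwoRowExpansion {n : ℕ} (M : Matrix (suc (suc n))) where

  complementaryMinor : Fin (suc (suc n)) → Fin (suc (suc n)) → ℤ
  complementaryMinor j b = det n (λ i l → M (suc (suc i)) (punchIn j (punchIn (punchOut′ j b) l)))

  kernel : Fin (suc (suc n)) → Fin (suc (suc n)) → ℤ
  kernel j b = (1ℤ - δ j b) * (sign j * sign (punchOut′ j b)) * complementaryMinor j b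

  kernel-antisym : ∀ j b → kernel j b ≡ - kernel b j
  kernel-antisym j b = by-cases (j ≟ b)
    where
    by-cases : Dec (j ≡ b) → kernel j b ≡ - kernel b j
    by-cases (yes refl) = begin
      (1ℤ - δ j j) * s * c  ≡⟨ cong (λ t → (1ℤ - t) * s * c) (δ-refl j) ⟩
      0ℤ * s * c            ≡⟨ zero-antisym s c ⟩
      - (0ℤ * s * c)        ≡⟨ cong (λ t → - ((1ℤ - t) * s * c)) (δ-refl j) ⟨
      - ((1ℤ - δ j j) * s * c) ∎
      where
      s = sign j * sign (punchOut′ j j)
      c = complementaryMinor j j
      zero-antisym : ∀ s c → 0ℤ * s * c ≡ - (0ℤ * s * c)
      zero-antisym = solve-∀
    by-cases (no j≢b) = begin
      (1ℤ - δ j b) * (sign j * sign (punchOut′ j b)) * complementaryMinor j b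
        ≡⟨ cong₂ (λ d t → (1ℤ - d) * t * complementaryMinor j b) (δ-≢ j≢b) (sign-punchOut′ j b j≢b) ⟩
      1ℤ * - s * complementaryMinor j b
        ≡⟨ cong (λ t → 1ℤ * - s * t) (det-cong n λ i l → cong (M (suc (suc i))) (punchIn-punchOut′-comm j b j≢b l)) ⟩
      1ℤ * - s * complementaryMinor b j
        ≡⟨ negate-middle s (complementaryMinor b j) ⟩
      - (1ℤ * s * complementaryMinor b j)
        ≡⟨ cong (λ d → - ((1ℤ - d) * s * complementaryMinor b j)) (δ-≢ (j≢b ∘ sym)) ⟨
      - ((1ℤ - δ b j) * s * complementaryMinor b j) ∎
      where
      s = sign b * sign (punchOut′ b j)
      negate-middle : ∀ s c → 1ℤ * - s * c ≡ - (1ℤ * s * c)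
      negate-middle = solve-∀

  det-withTopRows : ∀ R₀ R₁ →
    det (suc (suc n)) (withTopRows R₀ R₁ M) ≡ sum (λ j → sum (λ b → R₀ j * R₁ b * kernel j b))
  det-withTopRows R₀ R₁ = trans (det-expand T) (sum-cong-≗ expand-row₁)
    where
    T = withTopRows R₀ R₁ M
    H G : Fin (suc (suc n)) → Fin (suc (suc n)) → ℤ
    H j b = R₁ b * (sign (punchOut′ j b) * complementaryMinor j b)
    G j b = (1ℤ - δ j b) * H j b
    G-punchIn : ∀ j k → G j (punchIn j k) ≡ R₁ (punchIn j k) * cofactor (minor T j) k
    G-punchIn j k = begin
      G j (punchIn j k)
        ≡⟨ cong (λ d → (1ℤ - d) * H j (punchIn j k)) (δ-≢ (punchInᵢ≢i j k ∘ sym)) ⟩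
      1ℤ * H j (punchIn j k)
        ≡⟨ *-identityˡ (H j (punchIn j k)) ⟩
      R₁ (punchIn j k) * (sign (punchOut′ j (punchIn j k)) * complementaryMinor j (punchIn j k))
        ≡⟨ cong (λ k′ → R₁ (punchIn j k) * (sign k′ * det n (λ i l → M (suc (suc i)) (punchIn j (punchIn k′ l)))))
                (punchOut′-punchIn j k) ⟩
      R₁ (punchIn j k) * cofactor (minor T j) k ∎
    G-diag : ∀ j → G j j ≡ 0ℤ
    G-diag j = trans (cong (λ d → (1ℤ - d) * H j j) (δ-refl j)) (*-zeroˡ (H j j))
    expand-row₁ : ∀ j → T zero j * cofactor T j ≡ sum (λ b → R₀ j * R₁ b * kernel j b)
    expand-row₁ j = begin
      R₀ j * (sign j * det (suc n) (minor T j))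
        ≡⟨ cong (λ t → R₀ j * (sign j * t)) (det-expand (minor T j)) ⟩
      R₀ j * (sign j * sum (λ k → R₁ (punchIn j k) * cofactor (minor T j) k))
        ≡⟨ cong (λ t → R₀ j * (sign j * t)) (trans (sym (sum-cong-≗ (G-punchIn j))) (sym (sum-punchIn j (G j) (G-diag j)))) ⟩
      R₀ j * (sign j * sum (G j))
        ≡⟨ cong (R₀ j *_) (*-distribˡ-sum (sign j) (G j)) ⟩
      R₀ j * sum (λ b → sign j * G j b)
        ≡⟨ *-distribˡ-sum (R₀ j) (λ b → sign j * G j b) ⟩
      sum (λ b → R₀ j * (sign j * G j b))
        ≡⟨ sum-cong-≗ (λ b → regroup (R₀ j) (R₁ b) (sign j) (sign (punchOut′ j b)) (δ j b) (complementaryMinor j b)) ⟩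
      sum (λ b → R₀ j * R₁ b * kernel j b) ∎
      where
      regroup : ∀ r₀ r₁ s t d c → r₀ * (s * ((1ℤ - d) * (r₁ * (t * c)))) ≡ r₀ * r₁ * ((1ℤ - d) * (s * t) * c)
      regroup = solve-∀

det-swap₀₁ : ∀ {n} (M : Matrix (suc (suc n))) → det (suc (suc n)) (swap₀₁ M) ≡ - det (suc (suc n)) M
det-swap₀₁ {n} M = begin
  det N (withTopRows R₁ R₀ M)                           ≡⟨ det-withTopRows R₁ R₀ ⟩
  sum (λ j → sum (λ b → R₁ j * R₀ b * kernel j b))      ≡⟨ ∑-comm (λ j b → R₁ j * R₀ b * kernel j b) ⟩
  sum (λ b → sum (λ j → R₁ j * R₀ b * kernel j b))
    ≡⟨ sum-cong-≗ (λ b → sum-cong-≗ λ j → swap-factors (R₁ j) (R₀ b) (kernel j b) (kernel b j) (kernel-antisym j b)) ⟩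
  sum (λ b → sum (λ j → - (R₀ b * R₁ j * kernel b j)))  ≡⟨ sum-cong-≗ (λ b → neg-distrib-sum (λ j → R₀ b * R₁ j * kernel b j)) ⟨
  sum (λ b → - sum (λ j → R₀ b * R₁ j * kernel b j))    ≡⟨ neg-distrib-sum (λ b → sum (λ j → R₀ b * R₁ j * kernel b j)) ⟨
  - sum (λ b → sum (λ j → R₀ b * R₁ j * kernel b j))    ≡⟨ cong -_ (det-withTopRows R₀ R₁) ⟨
  - det N (withTopRows R₀ R₁ M)                         ≡⟨ cong -_ (det-cong N (withTopRows-id M)) ⟩
  - det N M                                             ∎
  where
  open TwoRowExpansion M
  N = suc (suc n)
  R₀ = M zero
  R₁ = M (suc zero)
  swap-factors : ∀ r₁ r₀ k k′ → k ≡ - k′ → r₁ * r₀ * k ≡ - (r₀ * r₁ * k′)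
  swap-factors r₁ r₀ k k′ refl = negate-out r₁ r₀ k′
    where
    negate-out : ∀ r₁ r₀ k′ → r₁ * r₀ * - k′ ≡ - (r₀ * r₁ * k′)
    negate-out = solve-∀

self-negative⇒zero : ∀ {d} → d ≡ - d → d ≡ 0ℤ
self-negative⇒zero {+ zero}   _  = refl
self-negative⇒zero {+[1+ n ]} ()
self-negative⇒zero { -[1+ n ]} ()

det-equalRows : ∀ {n} (M : Matrix n) (i j : Fin n) → i < j → (∀ c → M i c ≡ M j c) → det n M ≡ 0ℤ
det-equalRowsBelowTop : ∀ {n} (M : Matrix (suc n)) (i j : Fin n) → i < j →
                        (∀ c → M (suc i) c ≡ M (suc j) c) → det (suc n) M ≡ 0ℤ

det-equalRows M (suc i) (suc j) (s≤s i<j) Mi≗Mj = det-equalRowsBelowTop M i j i<j Mi≗Mj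
det-equalRows M zero (suc zero) _ M₀≗M₁ =
  self-negative⇒zero (trans (sym (det-cong _ swap-unchanged)) (det-swap₀₁ M))
  where
  swap-unchanged : ∀ i c → swap₀₁ M i c ≡ M i c
  swap-unchanged zero          c = sym (M₀≗M₁ c)
  swap-unchanged (suc zero)    c = M₀≗M₁ c
  swap-unchanged (suc (suc i)) c = refl
det-equalRows {suc (suc n)} M zero (suc (suc j)) _ M₀≗M = begin
  det N M                 ≡⟨ neg-involutive (det N M) ⟨
  - - det N M             ≡⟨ cong -_ (det-swap₀₁ M) ⟨
  - det N (swap₀₁ M)      ≡⟨ cong -_ (det-equalRowsBelowTop (swap₀₁ M) zero (suc j) (s≤s z≤n) M₀≗M) ⟩
  - 0ℤ                    ∎
  where N = suc (suc n)

det-equalRowsBelowTop M i j i<j Mi≗Mj = trans (det-expand M) (sum-zero λ k →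
  trans (cong (λ d → M zero k * (sign k * d)) (det-equalRows (minor M k) i j i<j (λ c → Mi≗Mj (punchIn k c))))
        (vanish (M zero k) (sign k)))
  where
  vanish : ∀ a s → a * (s * 0ℤ) ≡ 0ℤ
  vanish = solve-∀

replaceTopRow : ∀ {n} → Matrix (suc n) → (Fin (suc n) → ℤ) → Matrix (suc n)
replaceTopRow M R zero    = R
replaceTopRow M R (suc i) = M (suc i)

alien-cofactor-expansion : ∀ {n} (M : Matrix (suc n)) (k : Fin n) →
  sum (λ j → M (suc k) j * cofactor M j) ≡ 0ℤ
alien-cofactor-expansion M k =
  trans (sym (det-expand (replaceTopRow M (M (suc k)))))
        (det-equalRows (replaceTopRow M (M (suc k))) zero (suc k) (s≤s z≤n) (λ _ → refl))

det-addToTopRow : ∀ {n} (M : Matrix (suc n)) (a : ℤ) (c : Fin n → ℤ) →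
  det (suc n) (replaceTopRow M (λ j → a * M zero j + sum (λ k → c k * M (suc k) j))) ≡ a * det (suc n) M
det-addToTopRow {n} M a c = begin
  det (suc n) (replaceTopRow M R)
    ≡⟨ det-expand (replaceTopRow M R) ⟩
  sum (λ j → R j * cofactor M j)
    ≡⟨ sum-cong-≗ distribute ⟩
  sum (λ j → a * (M zero j * cofactor M j) + sum (λ k → c k * (M (suc k) j * cofactor M j)))
    ≡⟨ ∑-distrib-+ (λ j → a * (M zero j * cofactor M j)) (λ j → sum (λ k → c k * (M (suc k) j * cofactor M j))) ⟩
  sum (λ j → a * (M zero j * cofactor M j)) + sum (λ j → sum (λ k → c k * (M (suc k) j * cofactor M j)))
    ≡⟨ cong₂ _+_ (sym (*-distribˡ-sum a (λ j → M zero j * cofactor M j)))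
                 (∑-comm (λ j k → c k * (M (suc k) j * cofactor M j))) ⟩
  a * sum (λ j → M zero j * cofactor M j) + sum (λ k → sum (λ j → c k * (M (suc k) j * cofactor M j)))
    ≡⟨ cong₂ _+_ (cong (a *_) (sym (det-expand M)))
                 (sum-zero λ k → trans (sym (*-distribˡ-sum (c k) (λ j → M (suc k) j * cofactor M j)))
                                       (trans (cong (c k *_) (alien-cofactor-expansion M k)) (*-zeroʳ (c k)))) ⟩
  a * det (suc n) M + 0ℤ
    ≡⟨ +-identityʳ (a * det (suc n) M) ⟩
  a * det (suc n) M ∎
  where
  R : Fin (suc n) → ℤ
  R j = a * M zero j + sum (λ k → c k * M (suc k) j)
  distribute : ∀ j → R j * cofactor M j ≡ a * (M zero j * cofactor M j) + sum (λ k → c k * (M (suc k) j * cofactor M j))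
  distribute j = begin
    (a * M zero j + sum (λ k → c k * M (suc k) j)) * w
      ≡⟨ *-distribʳ-+ w (a * M zero j) _ ⟩
    a * M zero j * w + sum (λ k → c k * M (suc k) j) * w
      ≡⟨ cong₂ _+_ (*-assoc a (M zero j) w) (*-distribʳ-sum w (λ k → c k * M (suc k) j)) ⟩
    a * (M zero j * w) + sum (λ k → c k * M (suc k) j * w)
      ≡⟨ cong (_+_ (a * (M zero j * w))) (sum-cong-≗ λ k → *-assoc (c k) (M (suc k) j) w) ⟩
    a * (M zero j * w) + sum (λ k → c k * (M (suc k) j * w)) ∎
    where w = cofactor M j

det-topRowHead : ∀ {n} (M : Matrix (suc n)) → (∀ c → M zero (suc c) ≡ 0ℤ) →
  det (suc n) M ≡ M zero zero * det n (minor M zero)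
det-topRowHead {n} M row₀-tail≡0 = begin
  det (suc n) M                          ≡⟨ det-expand M ⟩
  sum (λ j → M zero j * cofactor M j)    ≡⟨ sum-head (λ j → M zero j * cofactor M j) (λ c → trans (cong (_* cofactor M (suc c)) (row₀-tail≡0 c))
                                                                    (*-zeroˡ (cofactor M (suc c)))) ⟩
  M zero zero * (1ℤ * det n (minor M zero)) ≡⟨ cong (M zero zero *_) (*-identityˡ (det n (minor M zero))) ⟩
  M zero zero * det n (minor M zero)     ∎

det-diagonal : ∀ n (M : Matrix n) (d : Fin n → ℤ) → (∀ i j → M i j ≡ δ i j * d i) → det n M ≡ prod d
det-diagonal zero    M d diagonal = refl
det-diagonal (suc n) M d diagonal = begin
  det (suc n) M                        ≡⟨ det-topRowHead M (λ c → trans (diagonal zero (suc c)) (*-zeroˡ (d zero))) ⟩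
  M zero zero * det n (minor M zero)   ≡⟨ cong₂ _*_ (trans (diagonal zero zero) (*-identityˡ (d zero)))
                                                    (det-diagonal n (minor M zero) (d ∘ suc) (λ i j → diagonal (suc i) (suc j))) ⟩
  d zero * prod (d ∘ suc)              ∎

det-blockTriangular : ∀ {n} (T : Matrix (suc (suc n))) →
  (∀ c → T zero (suc (suc c)) ≡ 0ℤ) → (∀ c → T (suc zero) (suc (suc c)) ≡ 0ℤ) →
  det (suc (suc n)) T ≡ (T zero zero * T (suc zero) (suc zero) - T zero (suc zero) * T (suc zero) zero)
                        * det n (λ i c → T (suc (suc i)) (suc (suc c)))
det-blockTriangular {n} T row₀-tail≡0 row₁-tail≡0 = begin
  det (suc (suc n)) T
    ≡⟨ det-expand T ⟩
  sum (λ j → T zero j * cofactor T j)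
    ≡⟨ sum-head₂ (λ j → T zero j * cofactor T j) (λ c → trans (cong (_* cofactor T (suc (suc c))) (row₀-tail≡0 c))
                                                              (*-zeroˡ (cofactor T (suc (suc c))))) ⟩
  T zero zero * (1ℤ * det (suc n) (minor T zero)) + T zero (suc zero) * (-1ℤ * det (suc n) (minor T (suc zero)))
    ≡⟨ cong₂ (λ u v → T zero zero * (1ℤ * u) + T zero (suc zero) * (-1ℤ * v))
             (det-topRowHead (minor T zero) row₁-tail≡0) (det-topRowHead (minor T (suc zero)) row₁-tail≡0) ⟩
  T zero zero * (1ℤ * (T (suc zero) (suc zero) * D)) + T zero (suc zero) * (-1ℤ * (T (suc zero) zero * D))
    ≡⟨ expand-2×2 (T zero zero) (T zero (suc zero)) (T (suc zero) zero) (T (suc zero) (suc zero)) D ⟩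
  (T zero zero * T (suc zero) (suc zero) - T zero (suc zero) * T (suc zero) zero) * D ∎
  where
  D = det n (λ i c → T (suc (suc i)) (suc (suc c)))
  expand-2×2 : ∀ a b c e D → a * (1ℤ * (e * D)) + b * (-1ℤ * (c * D)) ≡ (a * e - b * c) * D
  expand-2×2 = solve-∀

eliminate : ∀ {m} → Matrix (suc (suc m)) → ℤ → (Fin m → ℤ) → Fin (suc (suc m)) → Fin (suc (suc m)) → ℤ
eliminate M a e i j = a * M i j + sum (λ k → e k * M (suc (suc k)) j)

-- Replacing rows 0 and 1 by their eliminated versions multiplies det by a each time and
-- leaves a block triangular matrix.
det-borderedDiagonal : ∀ {m} (M : Matrix (suc (suc m))) (d : Fin m → ℤ) (a : ℤ) (e₀ e₁ : Fin m → ℤ) →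
  (∀ k c → M (suc (suc k)) (suc (suc c)) ≡ δ k c * d k) →
  (∀ c → a * M zero (suc (suc c)) + e₀ c * d c ≡ 0ℤ) →
  (∀ c → a * M (suc zero) (suc (suc c)) + e₁ c * d c ≡ 0ℤ) →
  a * (a * det (suc (suc m)) M)
    ≡ (eliminate M a e₀ zero zero * eliminate M a e₁ (suc zero) (suc zero)
       - eliminate M a e₀ zero (suc zero) * eliminate M a e₁ (suc zero) zero) * prod d
det-borderedDiagonal {m} M d a e₀ e₁ diagonal clear₀ clear₁ = begin
  a * (a * det N M)
    ≡⟨ double-negation a (det N M) ⟨
  - (a * - (a * det N M))
    ≡⟨ cong (λ t → - (a * - t)) (det-addToTopRow M a (0ℤ ∷ e₀)) ⟨
  - (a * - det N T₁)
    ≡⟨ cong (λ t → - (a * t)) (det-swap₀₁ T₁) ⟨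
  - (a * det N (swap₀₁ T₁))
    ≡⟨ cong -_ (det-addToTopRow (swap₀₁ T₁) a (0ℤ ∷ e₁)) ⟨
  - det N T₂
    ≡⟨ det-swap₀₁ T₂ ⟨
  det N T
    ≡⟨ det-blockTriangular T (λ c → trans (row-eliminated e₀ zero (suc (suc c))) (cleared e₀ zero clear₀ c))
                             (λ c → trans (row-eliminated e₁ (suc zero) (suc (suc c))) (cleared e₁ (suc zero) clear₁ c)) ⟩
  (T zero zero * T (suc zero) (suc zero) - T zero (suc zero) * T (suc zero) zero) * det m (λ i c → M (suc (suc i)) (suc (suc c)))
    ≡⟨ cong₂ (λ u v → u * v)
         (cong₂ _-_ (cong₂ _*_ (row-eliminated e₀ zero zero) (row-eliminated e₁ (suc zero) (suc zero)))
                    (cong₂ _*_ (row-eliminated e₀ zero (suc zero)) (row-eliminated e₁ (suc zero) zero)))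
         (det-diagonal m (λ i c → M (suc (suc i)) (suc (suc c))) d diagonal) ⟩
  (eliminate M a e₀ zero zero * eliminate M a e₁ (suc zero) (suc zero)
   - eliminate M a e₀ zero (suc zero) * eliminate M a e₁ (suc zero) zero) * prod d ∎
  where
  N = suc (suc m)
  combination : (Fin m → ℤ) → Matrix N → Fin N → ℤ
  combination e A j = a * A zero j + sum (λ k → (0ℤ ∷ e) k * A (suc k) j)
  T₁ T₂ T : Matrix N
  T₁ = replaceTopRow M (combination e₀ M)
  T₂ = replaceTopRow (swap₀₁ T₁) (combination e₁ (swap₀₁ T₁))
  T  = swap₀₁ T₂
  row-eliminated : ∀ e i j → a * M i j + (0ℤ + sum (λ k → e k * M (suc (suc k)) j)) ≡ eliminate M a e i j
  row-eliminated e i j = cong (_+_ (a * M i j)) (+-identityˡ (sum (λ k → e k * M (suc (suc k)) j)))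
  cleared : ∀ e i → (∀ c → a * M i (suc (suc c)) + e c * d c ≡ 0ℤ) → ∀ c → eliminate M a e i (suc (suc c)) ≡ 0ℤ
  cleared e i clear c = begin
    a * M i (suc (suc c)) + sum (λ k → e k * M (suc (suc k)) (suc (suc c)))
      ≡⟨ cong (_+_ (a * M i (suc (suc c)))) (sum-cong-≗ λ k → trans (cong (e k *_) (diagonal k c)) (swap-δ (e k) (δ k c) (d k))) ⟩
    a * M i (suc (suc c)) + sum (λ k → δ k c * (e k * d k))
      ≡⟨ cong (_+_ (a * M i (suc (suc c)))) (sum-δ c (λ k → e k * d k)) ⟩
    a * M i (suc (suc c)) + e c * d c
      ≡⟨ clear c ⟩
    0ℤ ∎
    where
    swap-δ : ∀ e δ d → e * (δ * d) ≡ δ * (e * d)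
    swap-δ = solve-∀
  double-negation : ∀ a t → - (a * - (a * t)) ≡ a * (a * t)
  double-negation = solve-∀


-- The binary star graph B′(p,q,r)

-- Powers are written out as products so that, once inlined, the ring solver can read the
-- definition; x⁴ is definitionally x ^ 4, and so on.
quartic : ℤ → ℤ → ℤ → ℤ → ℤ
quartic x P Q R =
  let x² = x * (x * 1ℤ); x³ = x * x²; x⁴ = x * x³ in
  x⁴ - (+ 2 * Q + P + R + + 6) * x³
     + (Q * Q + (P + R) * Q + P * R + + 4 * (+ 2 * Q + P + R) + + 13) * x²
     - (+ 2 * (Q * Q + P * Q + R * Q + P * R) + + 5 * (+ 2 * Q + P + R) + + 12) * x
     + (Q * Q + (P + R) * Q + + 2 * (+ 2 * Q + P + R) + + 4)
{-# INLINE quartic #-}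

quartic-root-2 : ∀ P R → quartic (+ 2) P 0ℤ R ≡ 0ℤ
quartic-root-2 = solve-∀

corner-identity : ∀ x P Q R →
  ((x - 1ℤ) * (x - + 2) * (x - (1ℤ + Q + P)) - Q * (x - 1ℤ) - P * (x - + 2))
    * ((x - 1ℤ) * (x - + 2) * (x - (1ℤ + Q + R)) - Q * (x - 1ℤ) - R * (x - + 2))
  - ((x - 1ℤ) * (x - + 2) - Q * (x - 1ℤ)) * ((x - 1ℤ) * (x - + 2) - Q * (x - 1ℤ))
  ≡ x * (x - + 2) * quartic x P Q R
corner-identity = solve-∀

vanishes-at-2 : ∀ p q r x → x - + 2 ≡ 0ℤ →
  x * (x - 1ℤ) ^ (p +ℕ r) * (x - + 2) ^ q * quartic x (+ p) (+ q) (+ r) ≡ 0ℤ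
vanishes-at-2 p zero r x x-2≡0 = begin
  x * (x - 1ℤ) ^ (p +ℕ r) * 1ℤ * quartic x (+ p) 0ℤ (+ r)
    ≡⟨ cong (λ y → x * (x - 1ℤ) ^ (p +ℕ r) * 1ℤ * quartic y (+ p) 0ℤ (+ r)) x≡2 ⟩
  x * (x - 1ℤ) ^ (p +ℕ r) * 1ℤ * quartic (+ 2) (+ p) 0ℤ (+ r)
    ≡⟨ cong (x * (x - 1ℤ) ^ (p +ℕ r) * 1ℤ *_) (quartic-root-2 (+ p) (+ r)) ⟩
  x * (x - 1ℤ) ^ (p +ℕ r) * 1ℤ * 0ℤ
    ≡⟨ *-zeroʳ (x * (x - 1ℤ) ^ (p +ℕ r) * 1ℤ) ⟩
  0ℤ ∎
  where
  x≡2 : x ≡ + 2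
  x≡2 = trans (add-back x) (cong (_+ + 2) x-2≡0)
    where add-back : ∀ x → x ≡ (x - + 2) + + 2
          add-back = solve-∀
vanishes-at-2 p (suc q) r x x-2≡0 = begin
  x * (x - 1ℤ) ^ (p +ℕ r) * ((x - + 2) * (x - + 2) ^ q) * Qr
    ≡⟨ cong (λ t → x * (x - 1ℤ) ^ (p +ℕ r) * (t * (x - + 2) ^ q) * Qr) x-2≡0 ⟩
  x * (x - 1ℤ) ^ (p +ℕ r) * (0ℤ * (x - + 2) ^ q) * Qr
    ≡⟨ factor-zero x ((x - 1ℤ) ^ (p +ℕ r)) ((x - + 2) ^ q) Qr ⟩
  0ℤ ∎
  where
  Qr = quartic x (+ p) (+ suc q) (+ r)
  factor-zero : ∀ a b c d → a * b * (0ℤ * c) * d ≡ 0ℤ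
  factor-zero = solve-∀

module Additive = Algebra.Properties.Monoid.Mult +-0-monoid
module Multiplicative = Algebra.Properties.Monoid.Mult *-1-monoid

×≡* : ∀ n v → n Additive.× v ≡ + n * v
×≡* zero    v = sym (*-zeroˡ v)
×≡* (suc n) v = trans (cong (_+_ v) (×≡* n v)) (successor v (+ n))
  where
  successor : ∀ v n → v + n * v ≡ (1ℤ + n) * v
  successor = solve-∀

×≡^ : ∀ n v → n Multiplicative.× v ≡ v ^ n
×≡^ zero    v = refl
×≡^ (suc n) v = cong (_*_ v) (×≡^ n v)

data Peripheral : Role → Set where
  isW  : Peripheral W
  isLU : Peripheral LU
  isLV : Peripheral LV

module BinaryStar (p q r : ℕ) (x : ℤ) where

  m : ℕ
  m = p +ℕ q +ℕ r

  P Q R : ℤ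
  P = + p
  Q = + q
  R = + r

  roleOf : Fin (suc (suc m)) → Role
  roleOf i = role p q (toℕ i)

  adjacency : Fin (suc (suc m)) → Fin (suc (suc m)) → Bool
  adjacency i j = roleAdj (roleOf i) (roleOf j)

  charMatrix : Matrix (suc (suc m))
  charMatrix i j = δ i j * x - Laplacian (suc (suc m)) adjacency i j

  edge : Role → Role → ℤ
  edge a b = if roleAdj a b then + 1 else + 0

  sum-roles : ∀ (g : Role → ℤ) → sum (λ c → g (roleOf (suc (suc c)))) ≡ Q * g W + (P * g LU + R * g LV)
  sum-roles g = trans (RoleFold.fold-role +-0-monoid p q r g)
                      (cong₂ _+_ (×≡* q (g W)) (cong₂ _+_ (×≡* p (g LU)) (×≡* r (g LV))))

  prod-roles : ∀ (g : Role → ℤ) → prod (λ c → g (roleOf (suc (suc c)))) ≡ g W ^ q * (g LU ^ p * g LV ^ r)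
  prod-roles g = trans (RoleFold.fold-role *-1-monoid p q r g)
                       (cong₂ _*_ (×≡^ q (g W)) (cong₂ _*_ (×≡^ p (g LU)) (×≡^ r (g LV))))

  deg : Role → ℤ
  deg U  = 1ℤ + Q + P
  deg V  = 1ℤ + Q + R
  deg W  = + 2
  deg LU = 1ℤ
  deg LV = 1ℤ

  degree-roleOf : ∀ i → degree (suc (suc m)) adjacency i ≡ deg (roleOf i)
  degree-roleOf i = begin
    edge a U + (edge a V + sumFin m (λ c → edge a (roleOf (suc (suc c)))))
      ≡⟨ cong (λ t → edge a U + (edge a V + t)) (trans (sumFin≡sum m _) (sum-roles (edge a))) ⟩
    edge a U + (edge a V + (Q * edge a W + (P * edge a LU + R * edge a LV)))
      ≡⟨ count a ⟩
    deg a ∎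
    where
    a = roleOf i
    count : ∀ a → edge a U + (edge a V + (Q * edge a W + (P * edge a LU + R * edge a LV))) ≡ deg a
    count U  = hub Q P R
      where hub : ∀ Q P R → + 0 + (+ 1 + (Q * + 1 + (P * + 1 + R * + 0))) ≡ 1ℤ + Q + P
            hub = solve-∀
    count V  = hub Q P R
      where hub : ∀ Q P R → + 1 + (+ 0 + (Q * + 1 + (P * + 0 + R * + 1))) ≡ 1ℤ + Q + R
            hub = solve-∀
    count W  = spoke Q P R
      where spoke : ∀ Q P R → + 1 + (+ 1 + (Q * + 0 + (P * + 0 + R * + 0))) ≡ + 2
            spoke = solve-∀
    count LU = leaf Q P R
      where leaf : ∀ Q P R → + 1 + (+ 0 + (Q * + 0 + (P * + 0 + R * + 0))) ≡ 1ℤ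
            leaf = solve-∀
    count LV = leaf Q P R
      where leaf : ∀ Q P R → + 0 + (+ 1 + (Q * + 0 + (P * + 0 + R * + 0))) ≡ 1ℤ
            leaf = solve-∀

  pivot : Role → ℤ
  pivot a = x - deg a

  entry : ∀ i j → charMatrix i j ≡ δ i j * pivot (roleOf i) + edge (roleOf i) (roleOf j)
  entry i j = trans (cong (λ t → δ i j * x - (δ i j * t - edge (roleOf i) (roleOf j))) (degree-roleOf i))
                    (regroup (δ i j) x (deg (roleOf i)) (edge (roleOf i) (roleOf j)))
    where
    regroup : ∀ d x D A → d * x - (d * D - A) ≡ d * (x - D) + A
    regroup = solve-∀

  offDiagonal : ∀ i j → i ≢ j → charMatrix i j ≡ edge (roleOf i) (roleOf j)
  offDiagonal i j i≢j = begin
    charMatrix i j                                         ≡⟨ entry i j ⟩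
    δ i j * pivot (roleOf i) + edge (roleOf i) (roleOf j)  ≡⟨ cong (λ d → d * pivot (roleOf i) + edge (roleOf i) (roleOf j)) (δ-≢ i≢j) ⟩
    0ℤ + edge (roleOf i) (roleOf j)                        ≡⟨ +-identityˡ (edge (roleOf i) (roleOf j)) ⟩
    edge (roleOf i) (roleOf j)                             ∎

  peripheral : ∀ k → Peripheral (roleOf (suc (suc k)))
  peripheral k = by-thresholds (toℕ k <ᵇ q) (toℕ k <ᵇ q +ℕ p)
    where
    by-thresholds : ∀ b b′ → Peripheral (if b then W else (if b′ then LU else LV))
    by-thresholds true  _     = isW
    by-thresholds false true  = isLU
    by-thresholds false false = isLV

  peripheral-nonadjacent : ∀ {a b} → Peripheral a → Peripheral b → edge a b ≡ 0ℤ
  peripheral-nonadjacent isW  isW  = refl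
  peripheral-nonadjacent isW  isLU = refl
  peripheral-nonadjacent isW  isLV = refl
  peripheral-nonadjacent isLU isW  = refl
  peripheral-nonadjacent isLU isLU = refl
  peripheral-nonadjacent isLU isLV = refl
  peripheral-nonadjacent isLV isW  = refl
  peripheral-nonadjacent isLV isLU = refl
  peripheral-nonadjacent isLV isLV = refl

  lowerBlock : ∀ k c → charMatrix (suc (suc k)) (suc (suc c)) ≡ δ k c * pivot (roleOf (suc (suc k)))
  lowerBlock k c = begin
    charMatrix (suc (suc k)) (suc (suc c))
      ≡⟨ entry (suc (suc k)) (suc (suc c)) ⟩
    δ k c * pivot (roleOf (suc (suc k))) + edge (roleOf (suc (suc k))) (roleOf (suc (suc c)))
      ≡⟨ cong (_+_ (δ k c * pivot (roleOf (suc (suc k))))) (peripheral-nonadjacent (peripheral k) (peripheral c)) ⟩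
    δ k c * pivot (roleOf (suc (suc k))) + 0ℤ
      ≡⟨ +-identityʳ (δ k c * pivot (roleOf (suc (suc k)))) ⟩
    δ k c * pivot (roleOf (suc (suc k))) ∎

  scale : ℤ
  scale = (x - 1ℤ) * (x - + 2)

  -- The multiplier of the row of a peripheral vertex b is - scale * edge h b / pivot b for the
  -- hub h, an exact division as pivot W = x - 2 and pivot LU = pivot LV = x - 1.
  multiplierU multiplierV : Role → ℤ
  multiplierU W  = - (x - 1ℤ)
  multiplierU LU = - (x - + 2)
  multiplierU _  = 0ℤ
  multiplierV W  = - (x - 1ℤ)
  multiplierV LV = - (x - + 2)
  multiplierV _  = 0ℤ

  clearsU : ∀ {b} → Peripheral b → scale * edge U b + multiplierU b * pivot b ≡ 0ℤ
  clearsU isW  = cancel x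
    where cancel : ∀ x → (x - 1ℤ) * (x - + 2) * + 1 + - (x - 1ℤ) * (x - + 2) ≡ 0ℤ
          cancel = solve-∀
  clearsU isLU = cancel x
    where cancel : ∀ x → (x - 1ℤ) * (x - + 2) * + 1 + - (x - + 2) * (x - 1ℤ) ≡ 0ℤ
          cancel = solve-∀
  clearsU isLV = trans (+-identityʳ (scale * 0ℤ)) (*-zeroʳ scale)

  clearsV : ∀ {b} → Peripheral b → scale * edge V b + multiplierV b * pivot b ≡ 0ℤ
  clearsV isW  = cancel x
    where cancel : ∀ x → (x - 1ℤ) * (x - + 2) * + 1 + - (x - 1ℤ) * (x - + 2) ≡ 0ℤ
          cancel = solve-∀
  clearsV isLU = trans (+-identityʳ (scale * 0ℤ)) (*-zeroʳ scale)
  clearsV isLV = cancel x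
    where cancel : ∀ x → (x - 1ℤ) * (x - + 2) * + 1 + - (x - + 2) * (x - 1ℤ) ≡ 0ℤ
          cancel = solve-∀

  hubSum : (Role → ℤ) → Role → ℤ
  hubSum e h = Q * (e W * edge W h) + (P * (e LU * edge LU h) + R * (e LV * edge LV h))

  eliminate-hubColumn : ∀ (e : Role → ℤ) i j → (∀ k → suc (suc k) ≢ j) →
    eliminate charMatrix scale (λ k → e (roleOf (suc (suc k)))) i j ≡ scale * charMatrix i j + hubSum e (roleOf j)
  eliminate-hubColumn e i j lower≢j = cong (_+_ (scale * charMatrix i j)) (begin
    sum (λ k → e (roleOf (suc (suc k))) * charMatrix (suc (suc k)) j)
      ≡⟨ sum-cong-≗ (λ k → cong (e (roleOf (suc (suc k))) *_) (offDiagonal (suc (suc k)) j (lower≢j k))) ⟩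
    sum (λ k → e (roleOf (suc (suc k))) * edge (roleOf (suc (suc k))) (roleOf j))
      ≡⟨ sum-roles (λ b → e b * edge b (roleOf j)) ⟩
    hubSum e (roleOf j) ∎)

  multipliersU multipliersV : Fin m → ℤ
  multipliersU k = multiplierU (roleOf (suc (suc k)))
  multipliersV k = multiplierV (roleOf (suc (suc k)))

  corner₀₀ : eliminate charMatrix scale multipliersU zero zero ≡ scale * (x - (1ℤ + Q + P)) - Q * (x - 1ℤ) - P * (x - + 2)
  corner₀₀ = trans (eliminate-hubColumn multiplierU zero zero (λ _ ()))
                   (trans (cong (λ t → scale * t + hubSum multiplierU U) (entry zero zero)) (simplify x Q P R))
    where
    simplify : ∀ x Q P R → (x - 1ℤ) * (x - + 2) * (1ℤ * (x - (1ℤ + Q + P)) + + 0)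
                             + (Q * (- (x - 1ℤ) * + 1) + (P * (- (x - + 2) * + 1) + R * + 0))
                           ≡ (x - 1ℤ) * (x - + 2) * (x - (1ℤ + Q + P)) - Q * (x - 1ℤ) - P * (x - + 2)
    simplify = solve-∀

  corner₀₁ : eliminate charMatrix scale multipliersU zero (suc zero) ≡ scale - Q * (x - 1ℤ)
  corner₀₁ = trans (eliminate-hubColumn multiplierU zero (suc zero) (λ _ ())) (simplify x Q P R)
    where
    simplify : ∀ x Q P R → (x - 1ℤ) * (x - + 2) * + 1
                             + (Q * (- (x - 1ℤ) * + 1) + (P * (- (x - + 2) * + 0) + R * + 0))
                           ≡ (x - 1ℤ) * (x - + 2) - Q * (x - 1ℤ)
    simplify = solve-∀

  corner₁₀ : eliminate charMatrix scale multipliersV (suc zero) zero ≡ scale - Q * (x - 1ℤ)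
  corner₁₀ = trans (eliminate-hubColumn multiplierV (suc zero) zero (λ _ ())) (simplify x Q P R)
    where
    simplify : ∀ x Q P R → (x - 1ℤ) * (x - + 2) * + 1
                             + (Q * (- (x - 1ℤ) * + 1) + (P * + 0 + R * (- (x - + 2) * + 0)))
                           ≡ (x - 1ℤ) * (x - + 2) - Q * (x - 1ℤ)
    simplify = solve-∀

  corner₁₁ : eliminate charMatrix scale multipliersV (suc zero) (suc zero) ≡ scale * (x - (1ℤ + Q + R)) - Q * (x - 1ℤ) - R * (x - + 2)
  corner₁₁ = trans (eliminate-hubColumn multiplierV (suc zero) (suc zero) (λ _ ()))
                   (trans (cong (λ t → scale * t + hubSum multiplierV V) (entry (suc zero) (suc zero))) (simplify x Q P R))
    where
    simplify : ∀ x Q P R → (x - 1ℤ) * (x - + 2) * (1ℤ * (x - (1ℤ + Q + R)) + + 0)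
                             + (Q * (- (x - 1ℤ) * + 1) + (P * + 0 + R * (- (x - + 2) * + 1)))
                           ≡ (x - 1ℤ) * (x - + 2) * (x - (1ℤ + Q + R)) - Q * (x - 1ℤ) - R * (x - + 2)
    simplify = solve-∀

  pivotOf : Fin m → ℤ
  pivotOf k = pivot (roleOf (suc (suc k)))

  scaled-charPoly : scale * (scale * det (suc (suc m)) charMatrix)
                    ≡ x * (x - + 2) * quartic x P Q R * ((x - + 2) ^ q * ((x - 1ℤ) ^ p * (x - 1ℤ) ^ r))
  scaled-charPoly = begin
    scale * (scale * det (suc (suc m)) charMatrix)
      ≡⟨ det-borderedDiagonal charMatrix pivotOf scale multipliersU multipliersV lowerBlock
           (λ c → trans (cong (λ t → scale * t + multipliersU c * pivotOf c) (offDiagonal zero (suc (suc c)) (λ ()))) (clearsU (peripheral c)))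
           (λ c → trans (cong (λ t → scale * t + multipliersV c * pivotOf c) (offDiagonal (suc zero) (suc (suc c)) (λ ()))) (clearsV (peripheral c))) ⟩
    (eliminate charMatrix scale multipliersU zero zero * eliminate charMatrix scale multipliersV (suc zero) (suc zero)
     - eliminate charMatrix scale multipliersU zero (suc zero) * eliminate charMatrix scale multipliersV (suc zero) zero) * prod pivotOf
      ≡⟨ cong₂ _*_ (trans (cong₂ _-_ (cong₂ _*_ corner₀₀ corner₁₁) (cong₂ _*_ corner₀₁ corner₁₀)) (corner-identity x P Q R))
                   (prod-roles pivot) ⟩
    x * (x - + 2) * quartic x P Q R * ((x - + 2) ^ q * ((x - 1ℤ) ^ p * (x - 1ℤ) ^ r)) ∎

  charPoly : det (suc (suc m)) charMatrix * (x - 1ℤ) ^ 2 * (x - + 2)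
             ≡ x * (x - 1ℤ) ^ (p +ℕ r) * (x - + 2) ^ q * quartic x P Q R
  charPoly = by-cases (x - + 2 ≟ℤ 0ℤ)
    where
    D = det (suc (suc m)) charMatrix
    RHS = x * (x - 1ℤ) ^ (p +ℕ r) * (x - + 2) ^ q * quartic x P Q R
    by-cases : Dec (x - + 2 ≡ 0ℤ) → D * (x - 1ℤ) ^ 2 * (x - + 2) ≡ RHS
    by-cases (yes x-2≡0) = begin
      D * (x - 1ℤ) ^ 2 * (x - + 2) ≡⟨ cong (D * (x - 1ℤ) ^ 2 *_) x-2≡0 ⟩
      D * (x - 1ℤ) ^ 2 * 0ℤ        ≡⟨ *-zeroʳ (D * (x - 1ℤ) ^ 2) ⟩
      0ℤ                           ≡⟨ vanishes-at-2 p q r x x-2≡0 ⟨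
      RHS                          ∎
    by-cases (no x-2≢0) = *-cancelˡ-≡ (x - + 2) _ _ {{≢-nonZero x-2≢0}} (begin
      (x - + 2) * (D * (x - 1ℤ) ^ 2 * (x - + 2))
        ≡⟨ regroup-left x D ⟩
      scale * (scale * D)
        ≡⟨ scaled-charPoly ⟩
      x * (x - + 2) * quartic x P Q R * ((x - + 2) ^ q * ((x - 1ℤ) ^ p * (x - 1ℤ) ^ r))
        ≡⟨ cong (λ t → x * (x - + 2) * quartic x P Q R * ((x - + 2) ^ q * t)) (^-distribˡ-+-* (x - 1ℤ) p r) ⟨
      x * (x - + 2) * quartic x P Q R * ((x - + 2) ^ q * (x - 1ℤ) ^ (p +ℕ r))
        ≡⟨ regroup-right x (quartic x P Q R) ((x - + 2) ^ q) ((x - 1ℤ) ^ (p +ℕ r)) ⟩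
      (x - + 2) * RHS ∎)
      where
      regroup-left : ∀ x D → (x - + 2) * (D * ((x - 1ℤ) * ((x - 1ℤ) * 1ℤ)) * (x - + 2))
                             ≡ (x - 1ℤ) * (x - + 2) * ((x - 1ℤ) * (x - + 2) * D)
      regroup-left = solve-∀
      regroup-right : ∀ x Qx W Y → x * (x - + 2) * Qx * (W * Y) ≡ (x - + 2) * (x * Y * W * Qx)
      regroup-right = solve-∀

cast-+ : ∀ a b {A B} → + a ≡ A → + b ≡ B → + (a +ℕ b) ≡ A + B
cast-+ a b refl refl = pos-+ a b

cast-* : ∀ a b {A B} → + a ≡ A → + b ≡ B → + (a *ℕ b) ≡ A * B
cast-* a b refl refl = pos-* a b

quartic-cast : ∀ p q r x →
  (x ^ 4)
    - (+ (2 *ℕ q +ℕ p +ℕ r +ℕ 6)) * (x ^ 3)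
    + (+ (q *ℕ q +ℕ (p +ℕ r) *ℕ q +ℕ p *ℕ r +ℕ 4 *ℕ (2 *ℕ q +ℕ p +ℕ r) +ℕ 13)) * (x ^ 2)
    - (+ (2 *ℕ (q *ℕ q +ℕ p *ℕ q +ℕ r *ℕ q +ℕ p *ℕ r) +ℕ 5 *ℕ (2 *ℕ q +ℕ p +ℕ r) +ℕ 12)) * x
    + (+ (q *ℕ q +ℕ (p +ℕ r) *ℕ q +ℕ 2 *ℕ (2 *ℕ q +ℕ p +ℕ r) +ℕ 4))
  ≡ quartic x (+ p) (+ q) (+ r)
quartic-cast p q r x = coefficients c₁ c₂ c₃ c₄
  where
  coefficients : ∀ {a₁ a₂ a₃ a₄ b₁ b₂ b₃ b₄} → a₁ ≡ b₁ → a₂ ≡ b₂ → a₃ ≡ b₃ → a₄ ≡ b₄ →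
    x ^ 4 - a₁ * x ^ 3 + a₂ * x ^ 2 - a₃ * x + a₄ ≡ x ^ 4 - b₁ * x ^ 3 + b₂ * x ^ 2 - b₃ * x + b₄
  coefficients refl refl refl refl = refl
  s = 2 *ℕ q +ℕ p +ℕ r
  s-cast : + s ≡ + 2 * + q + + p + + r
  s-cast = cast-+ (2 *ℕ q +ℕ p) r (cast-+ (2 *ℕ q) p (cast-* 2 q refl refl) refl) refl
  q²+[p+r]q : + (q *ℕ q +ℕ (p +ℕ r) *ℕ q) ≡ + q * + q + (+ p + + r) * + q
  q²+[p+r]q = cast-+ (q *ℕ q) ((p +ℕ r) *ℕ q) (cast-* q q refl refl) (cast-* (p +ℕ r) q (cast-+ p r refl refl) refl)
  c₁ : + (s +ℕ 6) ≡ + 2 * + q + + p + + r + + 6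
  c₁ = cast-+ s 6 s-cast refl
  c₂ : + (q *ℕ q +ℕ (p +ℕ r) *ℕ q +ℕ p *ℕ r +ℕ 4 *ℕ s +ℕ 13)
       ≡ + q * + q + (+ p + + r) * + q + + p * + r + + 4 * (+ 2 * + q + + p + + r) + + 13
  c₂ = cast-+ _ 13 (cast-+ _ (4 *ℕ s) (cast-+ _ (p *ℕ r) q²+[p+r]q (cast-* p r refl refl)) (cast-* 4 s refl s-cast)) refl
  c₃ : + (2 *ℕ (q *ℕ q +ℕ p *ℕ q +ℕ r *ℕ q +ℕ p *ℕ r) +ℕ 5 *ℕ s +ℕ 12)
       ≡ + 2 * (+ q * + q + + p * + q + + r * + q + + p * + r) + + 5 * (+ 2 * + q + + p + + r) + + 12
  c₃ = cast-+ _ 12 (cast-+ _ (5 *ℕ s) (cast-* 2 _ refl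
         (cast-+ _ (p *ℕ r) (cast-+ _ (r *ℕ q) (cast-+ (q *ℕ q) (p *ℕ q) (cast-* q q refl refl) (cast-* p q refl refl))
                                              (cast-* r q refl refl)) (cast-* p r refl refl)))
         (cast-* 5 s refl s-cast)) refl
  c₄ : + (q *ℕ q +ℕ (p +ℕ r) *ℕ q +ℕ 2 *ℕ s +ℕ 4) ≡ + q * + q + (+ p + + r) * + q + + 2 * (+ 2 * + q + + p + + r) + + 4
  c₄ = cast-+ _ 4 (cast-+ _ (2 *ℕ s) q²+[p+r]q (cast-* 2 s refl s-cast)) refl

mainTheorem4 : (p q r : ℕ) → (x : ℤ) →
    laplacianCharPoly (p +ℕ q +ℕ r +ℕ 2) (B'adj p q r) x
      * ((x - + 1) ^ 2) * (x - + 2)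
    ≡ x * ((x - + 1) ^ (p +ℕ r)) * ((x - + 2) ^ q)
      * ((x ^ 4)
         - (+ (2 *ℕ q +ℕ p +ℕ r +ℕ 6)) * (x ^ 3)
         + (+ (q *ℕ q +ℕ (p +ℕ r) *ℕ q +ℕ p *ℕ r +ℕ 4 *ℕ (2 *ℕ q +ℕ p +ℕ r) +ℕ 13)) * (x ^ 2)
         - (+ (2 *ℕ (q *ℕ q +ℕ p *ℕ q +ℕ r *ℕ q +ℕ p *ℕ r) +ℕ 5 *ℕ (2 *ℕ q +ℕ p +ℕ r) +ℕ 12)) * x
         + (+ (q *ℕ q +ℕ (p +ℕ r) *ℕ q +ℕ 2 *ℕ (2 *ℕ q +ℕ p +ℕ r) +ℕ 4)))
mainTheorem4 p q r x =
  trans (at-order (p +ℕ q +ℕ r +ℕ 2) (ℕ.+-comm (p +ℕ q +ℕ r) 2))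
        (cong (x * (x - + 1) ^ (p +ℕ r) * (x - + 2) ^ q *_) (sym (quartic-cast p q r x)))
  where
  at-order : ∀ n → n ≡ suc (suc (p +ℕ q +ℕ r)) →
    laplacianCharPoly n (λ i j → roleAdj (role p q (toℕ i)) (role p q (toℕ j))) x * (x - + 1) ^ 2 * (x - + 2)
    ≡ x * (x - + 1) ^ (p +ℕ r) * (x - + 2) ^ q * quartic x (+ p) (+ q) (+ r)
  at-order _ refl = BinaryStar.charPoly p q r x
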